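{- Let $m\ge 2$ be an integer with $\gcd(3,m)=1$, and let $v\in\mathbb{F}_{2^{3m}}^*$ satisfy $\mathrm{tr}_m^{3m}(v)=0$. Then the monomial $v\,x^{2^{3m-1}+2^{3m-2}-2^{2m-2}-2^{m-2}}$ is a complete permutation polynomial over $\mathbb{F}_{2^{3m}}$.
   Context: A polynomial $f\in\mathbb{F}_Q[x]$ is a complete permutation polynomial over $\mathbb{F}_Q$ if both $f(x)$ and $f(x)+x$ induce bijections of $\mathbb{F}_Q$. $\mathrm{tr}_m^{3m}(x)=x+x^{2^m}+x^{2^{2m}}$ is the relative trace from $\mathbb{F}_{2^{3m}}$ to $\mathbb{F}_{2^m}$. -}

module Defs where

open import Level using (0ℓ)
open import Data.Nat using (ℕ)
import Data.Nat as N
open import Data.Fin using (Fin)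
open import Data.Product using (∃; _×_)
open import Relation.Binary.PropositionalEquality using (_≡_)
open import Relation.Nullary using (¬_)
open import Algebra.Bundles using (CommutativeRing)
import Algebra.Bundles
open import Function.Definitions using (Bijective)
import Algebra.Definitions.RawSemiring as RS

record IsFiniteFieldOfOrder (R : CommutativeRing 0ℓ 0ℓ) (q : ℕ) : Set where
  open CommutativeRing R
  field
    0≉1     : ¬ (0# ≈ 1#)
    inverse : ∀ x → ¬ (x ≈ 0#) → ∃ λ y → x * y ≈ 1#
    enum    : Fin q → Carrier
    enum-injective  : ∀ i j → enum i ≈ enum j → i ≡ j
    enum-surjective : ∀ x → ∃ λ i → enum i ≈ x

module _ (R : CommutativeRing 0ℓ 0ℓ) where
  open CommutativeRing R
  open RS (Algebra.Bundles.Semiring.rawSemiring semiring) using () renaming (_^_ to _^ᴿ_)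

  pow : Carrier → ℕ → Carrier
  pow x n = x ^ᴿ n

  tr : ℕ → Carrier → Carrier
  tr m x = x + pow x (2 N.^ m) + pow x (2 N.^ (2 N.* m))

  IsPermutation : (Carrier → Carrier) → Set
  IsPermutation f = Bijective _≈_ _≈_ f

  IsCompletePermutation : (Carrier → Carrier) → Set
  IsCompletePermutation f = IsPermutation f × IsPermutation (λ x → f x + x)

-- the exponent 2^{3m-1} + 2^{3m-2} - 2^{2m-2} - 2^{m-2} (m ≥ 2, so no truncation)
exponent : ℕ → ℕ
exponent m = ((2 N.^ (3 N.* m N.∸ 1) N.+ 2 N.^ (3 N.* m N.∸ 2)) N.∸ 2 N.^ (2 N.* m N.∸ 2)) N.∸ 2 N.^ (m N.∸ 2)

{-# OPTIONS --safe #-}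
-- Let σ x = x ^ 2ᵐ, an automorphism of order 3 of the field F with 2³ᵐ elements, and
-- N x = x · σ x · σ² x the norm onto the fixed field K of σ. The exponent e satisfies
-- e (2 + 2ᵐ + 2²ᵐ) ≡ 1 modulo 2³ᵐ − 1, so y = x ^ e gives x = N y · y and x ↦ x ^ e is
-- injective. Next v x ^ e + x = (N y + v) y has norm c · N (c + v) with c = N y ∈ K.
-- Because tr v = 0, the map d ↦ d · N (d + v) = d⁴ + e₂ d² + N v · d is additive on K, and
-- N (d + v) ≠ 0 for d ∈ K since v ∉ K; hence it is injective on K, which recovers c and
-- then y. Injective self-maps of a finite field are bijective.
module Submission where

open import Defs
open import Level using (0ℓ)
open import Algebra.Bundles using (CommutativeRing)
import Algebra.Properties.CommutativeMonoid.Sum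
import Algebra.Properties.Group
open import Data.Nat using (ℕ; zero; suc; _≤_)
open import Data.Nat.GCD using (gcd)
import Data.Nat as ℕ
import Data.Nat.Properties as ℕ
open import Data.Fin using (Fin; zero; suc)
import Data.Fin as Fin
import Data.Fin.Properties as Fin
open import Data.Fin.Permutation using (Permutation′; permutation; _⟨$⟩ʳ_)
open import Data.Empty using (⊥-elim)
open import Data.Product using (∃; _,_; proj₁; proj₂)
open import Data.Sum using (_⊎_; inj₁; inj₂; [_,_]′)
open import Function using (id; _∘_)
open import Function.Definitions using (Congruent; Injective; Bijective; StrictlyInverseˡ; StrictlyInverseʳ)
open import Relation.Binary.PropositionalEquality using (_≡_; _≢_)
import Relation.Binary.PropositionalEquality as ≡
open import Relation.Nullary using (¬_; Dec; yes; no)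

module Exponent where

  open import Data.Nat using (pred; _+_; _*_; _^_; _∸_; s≤s; z≤n)
  open import Data.Nat.Properties using (^-distribˡ-+-*; +-identityʳ; *-assoc; m+n∸n≡m)
  open import Data.Nat.Tactic.RingSolver using (solve-∀)
  open import Relation.Binary.PropositionalEquality using (refl; sym; trans; cong; cong₂; module ≡-Reasoning)

  2^≡suc : ∀ k → ∃ λ b → 2 ^ k ≡ suc b
  2^≡suc zero    = 0 , refl
  2^≡suc (suc k) with b , eq ← 2^≡suc k = b + suc (b + 0) , cong (2 *_) eq

  2^[2*k] : ∀ k → 2 ^ (2 * k) ≡ 2 ^ k * 2 ^ k
  2^[2*k] k = trans (^-distribˡ-+-* 2 k (k + 0)) (cong (λ j → 2 ^ k * 2 ^ j) (+-identityʳ k))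

  2^[3*k] : ∀ k → 2 ^ (3 * k) ≡ 2 ^ k * (2 ^ k * 2 ^ k)
  2^[3*k] k = trans (^-distribˡ-+-* 2 k (2 * k)) (cong (2 ^ k *_) (2^[2*k] k))

  2^[c+j*k] : ∀ {i} c j k → i ≡ c + j * k → 2 ^ i ≡ 2 ^ c * 2 ^ (j * k)
  2^[c+j*k] c j k refl = ^-distribˡ-+-* 2 c (j * k)

  2*[2+k] : ∀ k → 2 * (2 + k) ≡ 4 + 2 * k
  2*[2+k] = solve-∀

  3*[2+k] : ∀ k → 3 * (2 + k) ≡ 6 + 3 * k
  3*[2+k] = solve-∀

  48*[1+b]³ : ∀ b → 32 * (suc b * (suc b * suc b)) + 16 * (suc b * (suc b * suc b))
    ≡ ((48 * (b * (b * b)) + 140 * (b * b) + 135 * b + 43) + suc b) + 4 * (suc b * suc b)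
  48*[1+b]³ = solve-∀

  exponent-product : ∀ b → (48 * (b * (b * b)) + 140 * (b * b) + 135 * b + 43) * (2 + 4 * suc b + 16 * (suc b * suc b))
    ≡ 1 + (12 * (suc b * suc b) + 2 * suc b + 1) * (64 * (b * (b * b)) + 192 * (b * b) + 192 * b + 63)
  exponent-product = solve-∀

  64*[1+b]³ : ∀ b → 64 * (suc b * (suc b * suc b)) ≡ suc (64 * (b * (b * b)) + 192 * (b * b) + 192 * b + 63)
  64*[1+b]³ = solve-∀

  -- Writing 2 ^ k = 1 + b makes every quantity a polynomial in b, so no subtraction truncates.
  exponent-2+ : ∀ k b → 2 ^ k ≡ suc b → exponent (2 + k) ≡ 48 * (b * (b * b)) + 140 * (b * b) + 135 * b + 43
  exponent-2+ k b 2^k≡1+b = begin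
    exponent (2 + k)
      ≡⟨ cong₂ (λ x y → ((x + y) ∸ 2 ^ (2 * (2 + k) ∸ 2)) ∸ 2 ^ k)
           (2^[c+j*k] 5 3 k (cong (_∸ 1) (3*[2+k] k))) (2^[c+j*k] 4 3 k (cong (_∸ 2) (3*[2+k] k))) ⟩
    ((32 * 2 ^ (3 * k) + 16 * 2 ^ (3 * k)) ∸ 2 ^ (2 * (2 + k) ∸ 2)) ∸ 2 ^ k
      ≡⟨ cong (λ x → ((32 * 2 ^ (3 * k) + 16 * 2 ^ (3 * k)) ∸ x) ∸ 2 ^ k) (2^[c+j*k] 2 2 k (cong (_∸ 2) (2*[2+k] k))) ⟩
    ((32 * 2 ^ (3 * k) + 16 * 2 ^ (3 * k)) ∸ 4 * 2 ^ (2 * k)) ∸ 2 ^ k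
      ≡⟨ cong₂ (λ x y → ((32 * x + 16 * x) ∸ 4 * y) ∸ 2 ^ k) (2^[3*k] k) (2^[2*k] k) ⟩
    ((32 * (t * (t * t)) + 16 * (t * (t * t))) ∸ 4 * (t * t)) ∸ t
      ≡⟨ cong (λ t → ((32 * (t * (t * t)) + 16 * (t * (t * t))) ∸ 4 * (t * t)) ∸ t) 2^k≡1+b ⟩
    ((32 * (B * (B * B)) + 16 * (B * (B * B))) ∸ 4 * (B * B)) ∸ B
      ≡⟨ cong (λ x → (x ∸ 4 * (B * B)) ∸ B) (48*[1+b]³ b) ⟩
    ((E + B) + 4 * (B * B)) ∸ 4 * (B * B) ∸ B
      ≡⟨ cong (_∸ B) (m+n∸n≡m (E + B) (4 * (B * B))) ⟩
    (E + B) ∸ B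
      ≡⟨ m+n∸n≡m E B ⟩
    E ∎
    where
    open ≡-Reasoning
    t B E : ℕ
    t = 2 ^ k
    B = suc b
    E = 48 * (b * (b * b)) + 140 * (b * b) + 135 * b + 43

  exponent-inverse : ∀ m → 2 ≤ m →
    ∃ λ K → exponent m * (2 + 2 ^ m + 2 ^ (2 * m)) ≡ 1 + K * pred (2 ^ (3 * m))
  exponent-inverse (suc (suc k)) (s≤s (s≤s z≤n)) with b , 2^k≡1+b ← 2^≡suc k =
    12 * (B * B) + 2 * B + 1 , (begin
      exponent (2 + k) * (2 + 2 ^ (2 + k) + 2 ^ (2 * (2 + k)))
        ≡⟨ cong₂ (λ e x → e * (2 + x + 2 ^ (2 * (2 + k)))) (exponent-2+ k b 2^k≡1+b)
             (trans (sym (*-assoc 2 2 (2 ^ k))) (cong (4 *_) 2^k≡1+b)) ⟩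
      E * (2 + 4 * B + 2 ^ (2 * (2 + k)))
        ≡⟨ cong (λ x → E * (2 + 4 * B + x))
             (trans (2^[c+j*k] 4 2 k (2*[2+k] k)) (cong (16 *_) (trans (2^[2*k] k) (cong (λ t → t * t) 2^k≡1+b)))) ⟩
      E * (2 + 4 * B + 16 * (B * B))
        ≡⟨ exponent-product b ⟩
      1 + K * (64 * (b * (b * b)) + 192 * (b * b) + 192 * b + 63)
        ≡⟨ cong (λ x → 1 + K * pred x) (sym (64*[1+b]³ b)) ⟩
      1 + K * pred (64 * (B * (B * B)))
        ≡⟨ cong (λ x → 1 + K * pred x)
             (sym (trans (2^[c+j*k] 6 3 k (3*[2+k] k)) (cong (64 *_) (trans (2^[3*k] k) (cong (λ t → t * (t * t)) 2^k≡1+b))))) ⟩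
      1 + K * pred (2 ^ (3 * (2 + k))) ∎)
    where
    open ≡-Reasoning
    B E K : ℕ
    B = suc b
    E = 48 * (b * (b * b)) + 140 * (b * b) + 135 * b + 43
    K = 12 * (B * B) + 2 * B + 1

Fin-injective⇒surjective : ∀ {n} (f : Fin n → Fin n) → (∀ {i j} → f i ≡ f j → i ≡ j) → ∀ j → ∃ λ i → f i ≡ j
Fin-injective⇒surjective {suc n} f f-inj j with Fin.any? (λ i → f i Fin.≟ j)
... | yes hit = hit
... | no miss
  with i , k , i<k , eq ← Fin.pigeonhole (ℕ.n<1+n n) (λ i → Fin.punchOut {i = j} (miss ∘ (i ,_) ∘ ≡.sym))
  = ⊥-elim (Fin.<⇒≢ i<k (f-inj (Fin.punchOut-injective (miss ∘ (i ,_) ∘ ≡.sym) (miss ∘ (k ,_) ∘ ≡.sym) eq)))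

module FiniteField (R : CommutativeRing 0ℓ 0ℓ) {q : ℕ} (F : IsFiniteFieldOfOrder R q) where

  open CommutativeRing R hiding (zero)
  open IsFiniteFieldOfOrder F
  open import Algebra.Properties.Semiring.Exp semiring using (_^_; ^-homo-*)
  open import Algebra.Definitions.RawMonoid +-rawMonoid using (_×_)
  open import Algebra.Properties.Semiring.Mult semiring using (×1-homo-*)
  open import Algebra.Properties.CommutativeSemigroup *-commutativeSemigroup using (x∙yz≈y∙xz)
  module + = Algebra.Properties.Group +-group
  module Σ+ = Algebra.Properties.CommutativeMonoid.Sum +-commutativeMonoid
  module Π* = Algebra.Properties.CommutativeMonoid.Sum *-commutativeMonoid
  open import Relation.Binary.Reasoning.Setoid setoid

  index : Carrier → Fin q
  index x = proj₁ (enum-surjective x)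

  enum-index : ∀ x → enum (index x) ≈ x
  enum-index x = proj₂ (enum-surjective x)

  instance
    q-nonZero : ℕ.NonZero q
    q-nonZero = Fin.nonZeroIndex (index 0#)

  _≟0 : ∀ x → Dec (x ≈ 0#)
  x ≟0 with index x Fin.≟ index 0#
  ... | yes eq = yes (trans (sym (enum-index x)) (trans (reflexive (≡.cong enum eq)) (enum-index 0#)))
  ... | no neq = no λ x≈0 → neq (enum-injective _ _ (trans (enum-index x) (trans x≈0 (sym (enum-index 0#)))))

  1≉0 : ¬ 1# ≈ 0#
  1≉0 1≈0 = 0≉1 (sym 1≈0)

  module _ {x} (x≉0 : ¬ x ≈ 0#) where

    x⁻¹ : Carrier
    x⁻¹ = proj₁ (inverse x x≉0)

    x*[x⁻¹*y]≈y : ∀ y → x * (x⁻¹ * y) ≈ y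
    x*[x⁻¹*y]≈y y = trans (sym (*-assoc _ _ _)) (trans (*-congʳ (proj₂ (inverse x x≉0))) (*-identityˡ y))

    x⁻¹*[x*y]≈y : ∀ y → x⁻¹ * (x * y) ≈ y
    x⁻¹*[x*y]≈y y = trans (x∙yz≈y∙xz _ _ _) (x*[x⁻¹*y]≈y y)

    *-cancelˡ : ∀ {y z} → x * y ≈ x * z → y ≈ z
    *-cancelˡ {y} {z} xy≈xz = trans (sym (x⁻¹*[x*y]≈y y)) (trans (*-congˡ xy≈xz) (x⁻¹*[x*y]≈y z))

  x*y≈0⇒x≈0∨y≈0 : ∀ {x y} → x * y ≈ 0# → x ≈ 0# ⊎ y ≈ 0#
  x*y≈0⇒x≈0∨y≈0 {x} {y} xy≈0 with x ≟0
  ... | yes x≈0 = inj₁ x≈0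
  ... | no  x≉0 = inj₂ (*-cancelˡ x≉0 (trans xy≈0 (sym (zeroʳ x))))

  x≉0∧y≉0⇒x*y≉0 : ∀ {x y} → ¬ x ≈ 0# → ¬ y ≈ 0# → ¬ x * y ≈ 0#
  x≉0∧y≉0⇒x*y≉0 x≉0 y≉0 xy≈0 = [ x≉0 , y≉0 ]′ (x*y≈0⇒x≈0∨y≈0 xy≈0)

  x^n≈0⇒x≈0 : ∀ {x} n → x ^ n ≈ 0# → x ≈ 0#
  x^n≈0⇒x≈0 zero    1≈0    = ⊥-elim (1≉0 1≈0)
  x^n≈0⇒x≈0 (suc n) xxⁿ≈0 = [ id , x^n≈0⇒x≈0 n ]′ (x*y≈0⇒x≈0∨y≈0 xxⁿ≈0)

  injective⇒bijective : ∀ {f} → Congruent _≈_ _≈_ f → Injective _≈_ _≈_ f → Bijective _≈_ _≈_ f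
  injective⇒bijective {f} f-cong f-inj = f-inj , surjective
    where
    f̂ : Fin q → Fin q
    f̂ i = index (f (enum i))
    f̂-injective : ∀ {i j} → f̂ i ≡ f̂ j → i ≡ j
    f̂-injective eq = enum-injective _ _
      (f-inj (trans (sym (enum-index _)) (trans (reflexive (≡.cong enum eq)) (enum-index _))))
    surjective : ∀ y → ∃ λ x → ∀ {z} → z ≈ x → f z ≈ y
    surjective y with i , f̂i≡y ← Fin-injective⇒surjective f̂ f̂-injective (index y) =
      enum i , λ z≈x → trans (f-cong z≈x)
        (trans (sym (enum-index _)) (trans (reflexive (≡.cong enum f̂i≡y)) (enum-index y)))

  permutationOf : ∀ f g → Congruent _≈_ _≈_ f → Congruent _≈_ _≈_ g →
    StrictlyInverseˡ _≈_ f g → StrictlyInverseʳ _≈_ f g → Permutation′ q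
  permutationOf f g f-cong g-cong fg gf = permutation (λ i → index (f (enum i))) (λ i → index (g (enum i)))
    (λ i → enum-injective _ _ (trans (enum-index _) (trans (f-cong (enum-index _)) (fg _))))
    (λ i → enum-injective _ _ (trans (enum-index _) (trans (g-cong (enum-index _)) (gf _))))

  q×x≈0 : ∀ x → q × x ≈ 0#
  q×x≈0 x = +.identityˡ-unique (q × x) (Σ+.sum enum) (begin
    q × x + Σ+.sum enum                   ≈⟨ +-congʳ (sym (Σ+.sum-replicate q)) ⟩
    Σ+.sum {q} (λ _ → x) + Σ+.sum enum    ≈⟨ sym (Σ+.∑-distrib-+ (λ _ → x) enum) ⟩
    Σ+.sum (λ i → x + enum i)             ≈⟨ Σ+.sum-cong-≋ (λ i → sym (enum-index (x + enum i))) ⟩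
    Σ+.sum (λ i → enum (π ⟨$⟩ʳ i))        ≈⟨ sym (Σ+.∑-permute enum π) ⟩
    Σ+.sum enum                           ∎)
    where
    π : Permutation′ q
    π = permutationOf (x +_) (- x +_) +-congˡ +-congˡ (+.\\-leftDividesˡ x) (+.\\-leftDividesʳ x)

  [1+1]^n≈2^n×1 : ∀ n → (1# + 1#) ^ n ≈ (2 ℕ.^ n) × 1#
  [1+1]^n≈2^n×1 zero    = sym (+-identityʳ 1#)
  [1+1]^n≈2^n×1 (suc n) = begin
    (1# + 1#) * (1# + 1#) ^ n       ≈⟨ *-cong (+-congˡ (sym (+-identityʳ 1#))) ([1+1]^n≈2^n×1 n) ⟩
    (2 × 1#) * ((2 ℕ.^ n) × 1#)     ≈⟨ sym (×1-homo-* 2 (2 ℕ.^ n)) ⟩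
    (2 ℕ.* 2 ℕ.^ n) × 1#            ∎

  characteristic-2 : ∀ n → q ≡ 2 ℕ.^ n → 1# + 1# ≈ 0#
  characteristic-2 n q≡2ⁿ =
    x^n≈0⇒x≈0 n (trans ([1+1]^n≈2^n×1 n) (≡.subst (λ k → k × 1# ≈ 0#) q≡2ⁿ (q×x≈0 1#)))

  -- Replacing 0 by 1 makes the product over the whole field a product of units.
  0↦1 : Carrier → Carrier
  0↦1 x with x ≟0
  ... | yes _ = 1#
  ... | no  _ = x

  0↦1-≉0 : ∀ x → ¬ 0↦1 x ≈ 0#
  0↦1-≉0 x with x ≟0
  ... | yes _   = 1≉0
  ... | no  x≉0 = x≉0

  0↦1-cong : Congruent _≈_ _≈_ 0↦1
  0↦1-cong {x} {y} x≈y with x ≟0 | y ≟0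
  ... | yes _   | yes _   = refl
  ... | yes x≈0 | no  y≉0 = ⊥-elim (y≉0 (trans (sym x≈y) x≈0))
  ... | no  x≉0 | yes y≈0 = ⊥-elim (x≉0 (trans x≈y y≈0))
  ... | no  _   | no  _   = x≈y

  0↦1-0 : ∀ {x} → x ≈ 0# → 0↦1 x ≈ 1#
  0↦1-0 {x} x≈0 with x ≟0
  ... | yes _   = refl
  ... | no  x≉0 = ⊥-elim (x≉0 x≈0)

  0↦1-≉0-id : ∀ {x} → ¬ x ≈ 0# → 0↦1 x ≈ x
  0↦1-≉0-id {x} x≉0 with x ≟0
  ... | yes x≈0 = ⊥-elim (x≉0 x≈0)
  ... | no  _   = refl

  Π-≉0 : ∀ {n} (a : Fin n → Carrier) → (∀ i → ¬ a i ≈ 0#) → ¬ Π*.sum a ≈ 0#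
  Π-≉0 {zero}  a a≉0 = 1≉0
  Π-≉0 {suc n} a a≉0 = x≉0∧y≉0⇒x*y≉0 (a≉0 zero) (Π-≉0 (a ∘ suc) (a≉0 ∘ suc))

  Π-update : ∀ {n} (a b : Fin n → Carrier) (k : Fin n) {c} → a k ≈ c * b k →
    (∀ i → i ≢ k → a i ≈ b i) → Π*.sum a ≈ c * Π*.sum b
  Π-update {suc n} a b zero    ak≈cbk rest =
    trans (*-cong ak≈cbk (Π*.sum-cong-≋ (λ i → rest (suc i) λ ()))) (*-assoc _ _ _)
  Π-update {suc n} a b (suc k) {c} ak≈cbk rest = begin
    a zero * Π*.sum (a ∘ suc)           ≈⟨ *-cong (rest zero λ ()) (Π-update (a ∘ suc) (b ∘ suc) k ak≈cbk
                                            (λ i i≢k → rest (suc i) (i≢k ∘ Fin.suc-injective))) ⟩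
    b zero * (c * Π*.sum (b ∘ suc))     ≈⟨ x∙yz≈y∙xz (b zero) c _ ⟩
    c * (b zero * Π*.sum (b ∘ suc))     ∎

  -- Π x · U eᵢ is both x ^ q · Π U and, reindexing along y ↦ x y, x · Π U: the index of 0 contributes x · 1 against 1.
  x^q≈x : ∀ x → x ^ q ≈ x
  x^q≈x x with x ≟0
  ... | yes x≈0 = begin
    x ^ q                ≈⟨ reflexive (≡.cong (x ^_) (≡.sym (ℕ.suc-pred q))) ⟩
    x * x ^ ℕ.pred q     ≈⟨ *-congʳ x≈0 ⟩
    0# * x ^ ℕ.pred q    ≈⟨ zeroˡ _ ⟩
    0#                   ≈⟨ sym x≈0 ⟩
    x                    ∎
  ... | no x≉0 = *-cancelˡ (Π-≉0 U (0↦1-≉0 ∘ enum)) (trans (*-comm _ _) (trans x^q*P≈x*P (*-comm _ _)))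
    where
    U : Fin q → Carrier
    U = 0↦1 ∘ enum
    π : Permutation′ q
    π = permutationOf (x *_) (x⁻¹ x≉0 *_) *-congˡ *-congˡ (x*[x⁻¹*y]≈y x≉0) (x⁻¹*[x*y]≈y x≉0)
    enum≉0 : ∀ i → i ≢ index 0# → ¬ enum i ≈ 0#
    enum≉0 i i≢0 eᵢ≈0 = i≢0 (enum-injective _ _ (trans eᵢ≈0 (sym (enum-index 0#))))
    x^q*P≈x*P : x ^ q * Π*.sum U ≈ x * Π*.sum U
    x^q*P≈x*P = begin
      x ^ q * Π*.sum U                         ≈⟨ *-congʳ (sym (Π*.sum-replicate q)) ⟩
      Π*.sum {q} (λ _ → x) * Π*.sum U          ≈⟨ sym (Π*.∑-distrib-+ (λ _ → x) U) ⟩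
      Π*.sum (λ i → x * 0↦1 (enum i))          ≈⟨ Π-update _ _ (index 0#)
          (*-congˡ (trans (0↦1-0 (enum-index 0#)) (sym (0↦1-0 (trans (*-congˡ (enum-index 0#)) (zeroʳ x))))))
          (λ i i≢0 → trans (*-congˡ (0↦1-≉0-id (enum≉0 i i≢0))) (sym (0↦1-≉0-id (x≉0∧y≉0⇒x*y≉0 x≉0 (enum≉0 i i≢0))))) ⟩
      x * Π*.sum (λ i → 0↦1 (x * enum i))      ≈⟨ *-congˡ (Π*.sum-cong-≋ (λ i → 0↦1-cong (sym (enum-index (x * enum i))))) ⟩
      x * Π*.sum (λ i → U (π ⟨$⟩ʳ i))          ≈⟨ *-congˡ (sym (Π*.∑-permute U π)) ⟩
      x * Π*.sum U                             ∎

  x^[1+k*[q-1]]≈x : ∀ k x → x ^ (1 ℕ.+ k ℕ.* ℕ.pred q) ≈ x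
  x^[1+k*[q-1]]≈x zero    x = *-identityʳ x
  x^[1+k*[q-1]]≈x (suc k) x = begin
    x ^ (1 ℕ.+ (ℕ.pred q ℕ.+ k ℕ.* ℕ.pred q))   ≈⟨ reflexive (≡.cong (x ^_) (≡.sym (ℕ.+-suc (ℕ.pred q) _))) ⟩
    x ^ (ℕ.pred q ℕ.+ (1 ℕ.+ k ℕ.* ℕ.pred q))   ≈⟨ ^-homo-* x (ℕ.pred q) _ ⟩
    x ^ ℕ.pred q * x ^ (1 ℕ.+ k ℕ.* ℕ.pred q)   ≈⟨ *-congˡ (x^[1+k*[q-1]]≈x k x) ⟩
    x ^ ℕ.pred q * x                            ≈⟨ *-comm _ _ ⟩
    x ^ ℕ.suc (ℕ.pred q)                        ≈⟨ reflexive (≡.cong (x ^_) (ℕ.suc-pred q)) ⟩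
    x ^ q                                       ≈⟨ x^q≈x x ⟩
    x                                           ∎

HasCharacteristic2 : CommutativeRing 0ℓ 0ℓ → Set
HasCharacteristic2 R = 1# + 1# ≈ 0#
  where open CommutativeRing R

module Characteristic2 (R : CommutativeRing 0ℓ 0ℓ) (1+1≈0 : HasCharacteristic2 R) where

  open CommutativeRing R

  open import Algebra.Properties.Semiring.Exp semiring using (_^_; ^-homo-*)
  open import Algebra.Solver.Ring.NaturalCoefficients.Default commutativeSemiring using (solve; _:=_; _:+_; _:*_)
  open import Relation.Binary.Reasoning.Setoid setoid

  x+x≈0 : ∀ x → x + x ≈ 0#
  x+x≈0 x = begin
    x + x                ≈⟨ +-cong (sym (*-identityʳ x)) (sym (*-identityʳ x)) ⟩
    x * 1# + x * 1#      ≈⟨ sym (distribˡ x 1# 1#) ⟩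
    x * (1# + 1#)        ≈⟨ *-congˡ 1+1≈0 ⟩
    x * 0#               ≈⟨ zeroʳ x ⟩
    0#                   ∎

  x+y≈0⇒x≈y : ∀ {x y} → x + y ≈ 0# → x ≈ y
  x+y≈0⇒x≈y {x} {y} x+y≈0 = begin
    x                    ≈⟨ sym (+-identityʳ x) ⟩
    x + 0#               ≈⟨ +-congˡ (sym (x+x≈0 y)) ⟩
    x + (y + y)          ≈⟨ sym (+-assoc _ _ _) ⟩
    (x + y) + y          ≈⟨ +-congʳ x+y≈0 ⟩
    0# + y               ≈⟨ +-identityˡ y ⟩
    y                    ∎

  [x+y]²≈x²+y² : ∀ x y → (x + y) * (x + y) ≈ x * x + y * y
  [x+y]²≈x²+y² x y = begin
    (x + y) * (x + y)                  ≈⟨ solve 2 (λ x y → (x :+ y) :* (x :+ y) := (x :* x :+ y :* y) :+ (x :* y :+ x :* y)) refl x y ⟩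
    (x * x + y * y) + (x * y + x * y)  ≈⟨ +-congˡ (x+x≈0 _) ⟩
    (x * x + y * y) + 0#               ≈⟨ +-identityʳ _ ⟩
    x * x + y * y                      ∎

  [x+y]^2ⁿ≈x^2ⁿ+y^2ⁿ : ∀ n x y → (x + y) ^ (2 ℕ.^ n) ≈ x ^ (2 ℕ.^ n) + y ^ (2 ℕ.^ n)
  [x+y]^2ⁿ≈x^2ⁿ+y^2ⁿ zero    x y = distribʳ 1# x y
  [x+y]^2ⁿ≈x^2ⁿ+y^2ⁿ (suc n) x y = begin
    (x + y) ^ (2 ℕ.* t)                ≈⟨ ^[2*k]≈square (x + y) t ⟩
    (x + y) ^ t * (x + y) ^ t          ≈⟨ *-cong ([x+y]^2ⁿ≈x^2ⁿ+y^2ⁿ n x y) ([x+y]^2ⁿ≈x^2ⁿ+y^2ⁿ n x y) ⟩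
    (x ^ t + y ^ t) * (x ^ t + y ^ t)  ≈⟨ [x+y]²≈x²+y² _ _ ⟩
    x ^ t * x ^ t + y ^ t * y ^ t      ≈⟨ +-cong (sym (^[2*k]≈square x t)) (sym (^[2*k]≈square y t)) ⟩
    x ^ (2 ℕ.* t) + y ^ (2 ℕ.* t)      ∎
    where
    t : ℕ
    t = 2 ℕ.^ n
    ^[2*k]≈square : ∀ x k → x ^ (2 ℕ.* k) ≈ x ^ k * x ^ k
    ^[2*k]≈square x k = trans (^-homo-* x k (k ℕ.+ 0)) (*-congˡ (reflexive (≡.cong (x ^_) (ℕ.+-identityʳ k))))

module CubicExtension (R : CommutativeRing 0ℓ 0ℓ) (m : ℕ) (F : IsFiniteFieldOfOrder R (2 ℕ.^ (3 ℕ.* m))) where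

  open CommutativeRing R hiding (zero)
  open FiniteField R F
  open Characteristic2 R (characteristic-2 (3 ℕ.* m) ≡.refl)
  open import Algebra.Properties.Semiring.Exp semiring using (_^_; ^-congˡ; ^-homo-*; ^-assocʳ)
  open import Algebra.Properties.CommutativeSemiring.Exp commutativeSemiring using (^-distrib-*)
  open import Algebra.Solver.Ring.NaturalCoefficients.Default commutativeSemiring using (solve; _:=_; _:+_; _:*_)
  open import Relation.Binary.Reasoning.Setoid setoid

  σ : Carrier → Carrier
  σ x = x ^ (2 ℕ.^ m)

  σ-cong : Congruent _≈_ _≈_ σ
  σ-cong = ^-congˡ (2 ℕ.^ m)

  σ-+ : ∀ x y → σ (x + y) ≈ σ x + σ y
  σ-+ = [x+y]^2ⁿ≈x^2ⁿ+y^2ⁿ m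

  σ-* : ∀ x y → σ (x * y) ≈ σ x * σ y
  σ-* x y = ^-distrib-* x y (2 ℕ.^ m)

  x^2²ᵐ≈σ²x : ∀ x → x ^ (2 ℕ.^ (2 ℕ.* m)) ≈ σ (σ x)
  x^2²ᵐ≈σ²x x = trans (reflexive (≡.cong (x ^_) (Exponent.2^[2*k] m))) (sym (^-assocʳ x (2 ℕ.^ m) (2 ℕ.^ m)))

  σ³≈id : ∀ x → σ (σ (σ x)) ≈ x
  σ³≈id x = begin
    σ (σ (σ x))                                ≈⟨ σ-cong (sym (x^2²ᵐ≈σ²x x)) ⟩
    (x ^ (2 ℕ.^ (2 ℕ.* m))) ^ (2 ℕ.^ m)        ≈⟨ ^-assocʳ x (2 ℕ.^ (2 ℕ.* m)) (2 ℕ.^ m) ⟩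
    x ^ (2 ℕ.^ (2 ℕ.* m) ℕ.* 2 ℕ.^ m)          ≈⟨ reflexive (≡.cong (x ^_) 2²ᵐ*2ᵐ≡2³ᵐ) ⟩
    x ^ (2 ℕ.^ (3 ℕ.* m))                      ≈⟨ x^q≈x x ⟩
    x                                          ∎
    where
    2²ᵐ*2ᵐ≡2³ᵐ : 2 ℕ.^ (2 ℕ.* m) ℕ.* 2 ℕ.^ m ≡ 2 ℕ.^ (3 ℕ.* m)
    2²ᵐ*2ᵐ≡2³ᵐ = ≡.trans (ℕ.*-comm _ (2 ℕ.^ m)) (≡.sym (ℕ.^-distribˡ-+-* 2 m (2 ℕ.* m)))

  tr≈x+σx+σ²x : ∀ x → tr R m x ≈ x + σ x + σ (σ x)
  tr≈x+σx+σ²x x = +-congˡ (x^2²ᵐ≈σ²x x)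

  norm : Carrier → Carrier
  norm x = x * (σ x * σ (σ x))

  norm-cong : Congruent _≈_ _≈_ norm
  norm-cong x≈y = *-cong x≈y (*-cong (σ-cong x≈y) (σ-cong (σ-cong x≈y)))

  norm-* : ∀ x y → norm (x * y) ≈ norm x * norm y
  norm-* x y = begin
    (x * y) * (σ (x * y) * σ (σ (x * y)))            ≈⟨ *-congˡ (*-cong (σ-* x y) (trans (σ-cong (σ-* x y)) (σ-* _ _))) ⟩
    (x * y) * ((σ x * σ y) * (σ (σ x) * σ (σ y)))    ≈⟨ solve 6 (λ x y x′ y′ x″ y″ → (x :* y) :* ((x′ :* y′) :* (x″ :* y″))
                                                          := (x :* (x′ :* x″)) :* (y :* (y′ :* y″))) refl
                                                          x y (σ x) (σ y) (σ (σ x)) (σ (σ y)) ⟩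
    norm x * norm y                                  ∎

  σ-norm≈norm : ∀ x → σ (norm x) ≈ norm x
  σ-norm≈norm x = begin
    σ (x * (σ x * σ (σ x)))          ≈⟨ trans (σ-* _ _) (*-congˡ (σ-* _ _)) ⟩
    σ x * (σ (σ x) * σ (σ (σ x)))    ≈⟨ *-congˡ (*-congˡ (σ³≈id x)) ⟩
    σ x * (σ (σ x) * x)              ≈⟨ solve 3 (λ x x′ x″ → x′ :* (x″ :* x) := x :* (x′ :* x″)) refl x (σ x) (σ (σ x)) ⟩
    norm x                           ∎

  norm≈0⇒x≈0 : ∀ {x} → norm x ≈ 0# → x ≈ 0#
  norm≈0⇒x≈0 {x} Nx≈0 with x*y≈0⇒x≈0∨y≈0 Nx≈0
  ... | inj₁ x≈0    = x≈0
  ... | inj₂ σxσ²x≈0 with x*y≈0⇒x≈0∨y≈0 σxσ²x≈0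
  ...   | inj₁ σx≈0  = x^n≈0⇒x≈0 (2 ℕ.^ m) σx≈0
  ...   | inj₂ σ²x≈0 = x^n≈0⇒x≈0 (2 ℕ.^ m) (x^n≈0⇒x≈0 (2 ℕ.^ m) σ²x≈0)

  module TraceZero (v : Carrier) (v≉0 : ¬ v ≈ 0#) (trv≈0 : tr R m v ≈ 0#) where

    e₂ : Carrier
    e₂ = v * σ v + v * σ (σ v) + σ v * σ (σ v)

    linearised : Carrier → Carrier
    linearised d = (d * d) * (d * d) + e₂ * (d * d) + norm v * d

    linearised-+ : ∀ a b → linearised (a + b) ≈ linearised a + linearised b
    linearised-+ a b = begin
      ((a + b) * (a + b)) * ((a + b) * (a + b)) + e₂ * ((a + b) * (a + b)) + norm v * (a + b)
        ≈⟨ +-congʳ (+-cong (*-cong ([x+y]²≈x²+y² a b) ([x+y]²≈x²+y² a b)) (*-congˡ ([x+y]²≈x²+y² a b))) ⟩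
      (a * a + b * b) * (a * a + b * b) + e₂ * (a * a + b * b) + norm v * (a + b)
        ≈⟨ +-congʳ (+-congʳ ([x+y]²≈x²+y² _ _)) ⟩
      ((a * a) * (a * a) + (b * b) * (b * b)) + e₂ * (a * a + b * b) + norm v * (a + b)
        ≈⟨ solve 4 (λ a b s n → ((a :* a) :* (a :* a) :+ (b :* b) :* (b :* b)) :+ s :* (a :* a :+ b :* b) :+ n :* (a :+ b)
             := ((a :* a) :* (a :* a) :+ s :* (a :* a) :+ n :* a) :+ ((b :* b) :* (b :* b) :+ s :* (b :* b) :+ n :* b))
             refl a b e₂ (norm v) ⟩
      linearised a + linearised b ∎

    -- (d + v)(d + σ v)(d + σ² v) = d³ + d² tr v + e₂ d + norm v
    d*norm[d+v]≈linearised : ∀ {d} → σ d ≈ d → d * norm (d + v) ≈ linearised d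
    d*norm[d+v]≈linearised {d} σd≈d = begin
      d * ((d + v) * (σ (d + v) * σ (σ (d + v))))            ≈⟨ *-congˡ (*-congˡ (*-cong σ[d+v]≈d+σv σ²[d+v]≈d+σ²v)) ⟩
      d * ((d + v) * ((d + σ v) * (d + σ (σ v))))            ≈⟨ solve 4 (λ d v v′ v″ →
          d :* ((d :+ v) :* ((d :+ v′) :* (d :+ v″)))
            := ((d :* d) :* (d :* d) :+ (v :* v′ :+ v :* v″ :+ v′ :* v″) :* (d :* d) :+ (v :* (v′ :* v″)) :* d)
               :+ (d :* (d :* d)) :* (v :+ v′ :+ v″)) refl d v (σ v) (σ (σ v)) ⟩
      linearised d + (d * (d * d)) * (v + σ v + σ (σ v))      ≈⟨ +-congˡ (*-congˡ (trans (sym (tr≈x+σx+σ²x v)) trv≈0)) ⟩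
      linearised d + (d * (d * d)) * 0#                      ≈⟨ +-congˡ (zeroʳ _) ⟩
      linearised d + 0#                                      ≈⟨ +-identityʳ _ ⟩
      linearised d                                           ∎
      where
      σ[d+v]≈d+σv : σ (d + v) ≈ d + σ v
      σ[d+v]≈d+σv = trans (σ-+ d v) (+-congʳ σd≈d)
      σ²[d+v]≈d+σ²v : σ (σ (d + v)) ≈ d + σ (σ v)
      σ²[d+v]≈d+σ²v = trans (σ-cong σ[d+v]≈d+σv) (trans (σ-+ d (σ v)) (+-congʳ σd≈d))

    -- A σ-fixed v would have trace v + v + v = v ≉ 0.
    fixed+v≉0 : ∀ {d} → σ d ≈ d → ¬ d + v ≈ 0#
    fixed+v≉0 {d} σd≈d d+v≈0 = v≉0 (begin
      v                        ≈⟨ sym (+-identityˡ v) ⟩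
      0# + v                   ≈⟨ +-congʳ (sym (x+x≈0 v)) ⟩
      v + v + v                ≈⟨ sym (+-cong (+-congˡ σv≈v) (trans (σ-cong σv≈v) σv≈v)) ⟩
      v + σ v + σ (σ v)        ≈⟨ sym (tr≈x+σx+σ²x v) ⟩
      tr R m v                 ≈⟨ trv≈0 ⟩
      0#                       ∎)
      where
      d≈v : d ≈ v
      d≈v = x+y≈0⇒x≈y d+v≈0
      σv≈v : σ v ≈ v
      σv≈v = trans (σ-cong (sym d≈v)) (trans σd≈d d≈v)

    d*norm[d+v]-injective : ∀ {a b} → σ a ≈ a → σ b ≈ b → a * norm (a + v) ≈ b * norm (b + v) → a ≈ b
    d*norm[d+v]-injective {a} {b} σa≈a σb≈b eq =
      [ x+y≈0⇒x≈y , ⊥-elim ∘ fixed+v≉0 σ[a+b]≈a+b ∘ norm≈0⇒x≈0 ]′ (x*y≈0⇒x≈0∨y≈0 (begin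
        (a + b) * norm (a + b + v)            ≈⟨ d*norm[d+v]≈linearised σ[a+b]≈a+b ⟩
        linearised (a + b)                    ≈⟨ linearised-+ a b ⟩
        linearised a + linearised b           ≈⟨ +-congʳ (trans (sym (d*norm[d+v]≈linearised σa≈a))
                                                   (trans eq (d*norm[d+v]≈linearised σb≈b))) ⟩
        linearised b + linearised b           ≈⟨ x+x≈0 _ ⟩
        0#                                    ∎))
      where
      σ[a+b]≈a+b : σ (a + b) ≈ a + b
      σ[a+b]≈a+b = trans (σ-+ a b) (+-cong σa≈a σb≈b)

  module PowerMap (e K : ℕ) (e-inverse : e ℕ.* (2 ℕ.+ 2 ℕ.^ m ℕ.+ 2 ℕ.^ (2 ℕ.* m)) ≡ 1 ℕ.+ K ℕ.* ℕ.pred (2 ℕ.^ (3 ℕ.* m))) where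

    norm[x^e]*x^e≈x : ∀ x → norm (x ^ e) * x ^ e ≈ x
    norm[x^e]*x^e≈x x = begin
      (y * (σ y * σ (σ y))) * y                  ≈⟨ solve 3 (λ y y′ y″ → (y :* (y′ :* y″)) :* y := ((y :* y) :* y′) :* y″) refl y (σ y) (σ (σ y)) ⟩
      ((y * y) * σ y) * σ (σ y)                  ≈⟨ *-cong (*-congʳ (*-congˡ (sym (*-identityʳ y)))) (sym (x^2²ᵐ≈σ²x y)) ⟩
      (y ^ 2 * y ^ 2ᵐ) * y ^ 2²ᵐ                 ≈⟨ *-congʳ (sym (^-homo-* y 2 2ᵐ)) ⟩
      y ^ (2 ℕ.+ 2ᵐ) * y ^ 2²ᵐ                   ≈⟨ sym (^-homo-* y (2 ℕ.+ 2ᵐ) 2²ᵐ) ⟩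
      y ^ (2 ℕ.+ 2ᵐ ℕ.+ 2²ᵐ)                      ≈⟨ ^-assocʳ x e (2 ℕ.+ 2ᵐ ℕ.+ 2²ᵐ) ⟩
      x ^ (e ℕ.* (2 ℕ.+ 2ᵐ ℕ.+ 2²ᵐ))             ≈⟨ reflexive (≡.cong (x ^_) e-inverse) ⟩
      x ^ (1 ℕ.+ K ℕ.* ℕ.pred (2 ℕ.^ (3 ℕ.* m)))  ≈⟨ x^[1+k*[q-1]]≈x K x ⟩
      x                                          ∎
      where
      y : Carrier
      y = x ^ e
      2ᵐ 2²ᵐ : ℕ
      2ᵐ = 2 ℕ.^ m
      2²ᵐ = 2 ℕ.^ (2 ℕ.* m)

    x^e-injective : ∀ {x y} → x ^ e ≈ y ^ e → x ≈ y
    x^e-injective {x} {y} xᵉ≈yᵉ =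
      trans (sym (norm[x^e]*x^e≈x x)) (trans (*-cong (norm-cong xᵉ≈yᵉ) xᵉ≈yᵉ) (norm[x^e]*x^e≈x y))

    module _ (v : Carrier) (v≉0 : ¬ v ≈ 0#) (trv≈0 : tr R m v ≈ 0#) where

      open TraceZero v v≉0 trv≈0

      v*x^e+x≈[norm[x^e]+v]*x^e : ∀ x → v * x ^ e + x ≈ (norm (x ^ e) + v) * x ^ e
      v*x^e+x≈[norm[x^e]+v]*x^e x = begin
        v * x ^ e + x                           ≈⟨ +-congˡ (sym (norm[x^e]*x^e≈x x)) ⟩
        v * x ^ e + norm (x ^ e) * x ^ e        ≈⟨ +-comm _ _ ⟩
        norm (x ^ e) * x ^ e + v * x ^ e        ≈⟨ sym (distribʳ _ _ _) ⟩
        (norm (x ^ e) + v) * x ^ e              ∎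

      norm[v*x^e+x] : ∀ x → norm (v * x ^ e + x) ≈ norm (x ^ e) * norm (norm (x ^ e) + v)
      norm[v*x^e+x] x = begin
        norm (v * x ^ e + x)                    ≈⟨ norm-cong (v*x^e+x≈[norm[x^e]+v]*x^e x) ⟩
        norm ((norm (x ^ e) + v) * x ^ e)       ≈⟨ norm-* _ _ ⟩
        norm (norm (x ^ e) + v) * norm (x ^ e)  ≈⟨ *-comm _ _ ⟩
        norm (x ^ e) * norm (norm (x ^ e) + v)  ∎

      v*x^e+x-injective : ∀ {x y} → v * x ^ e + x ≈ v * y ^ e + y → x ≈ y
      v*x^e+x-injective {x} {y} eq = x^e-injective (*-cancelˡ (fixed+v≉0 (σ-norm≈norm (x ^ e))) (begin
        (norm (x ^ e) + v) * x ^ e     ≈⟨ sym (v*x^e+x≈[norm[x^e]+v]*x^e x) ⟩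
        v * x ^ e + x                  ≈⟨ eq ⟩
        v * y ^ e + y                  ≈⟨ v*x^e+x≈[norm[x^e]+v]*x^e y ⟩
        (norm (y ^ e) + v) * y ^ e     ≈⟨ *-congʳ (+-congʳ (sym norm[x^e]≈norm[y^e])) ⟩
        (norm (x ^ e) + v) * y ^ e     ∎))
        where
        norm[x^e]≈norm[y^e] : norm (x ^ e) ≈ norm (y ^ e)
        norm[x^e]≈norm[y^e] = d*norm[d+v]-injective (σ-norm≈norm (x ^ e)) (σ-norm≈norm (y ^ e))
          (trans (sym (norm[v*x^e+x] x)) (trans (norm-cong eq) (norm[v*x^e+x] y)))

      v*x^e-complete : IsCompletePermutation R (λ x → v * x ^ e)
      v*x^e-complete =
          injective⇒bijective (*-congˡ ∘ ^-congˡ e) (x^e-injective ∘ *-cancelˡ v≉0)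
        , injective⇒bijective (λ x≈y → +-cong (*-congˡ (^-congˡ e x≈y)) x≈y) v*x^e+x-injective

open import Data.Nat using (_*_; _^_)

theorem7 : (m : ℕ) → 2 ≤ m → gcd 3 m ≡ 1 →
    (F : CommutativeRing 0ℓ 0ℓ) → IsFiniteFieldOfOrder F (2 ^ (3 * m)) →
    (v : CommutativeRing.Carrier F) → ¬ (CommutativeRing._≈_ F v (CommutativeRing.0# F)) →
    CommutativeRing._≈_ F (tr F m v) (CommutativeRing.0# F) →
    IsCompletePermutation F (λ x → CommutativeRing._*_ F v (pow F x (exponent m)))
theorem7 m 2≤m _ F isField v v≉0 trv≈0 with K , e-inverse ← Exponent.exponent-inverse m 2≤m =
  CubicExtension.PowerMap.v*x^e-complete F m isField (exponent m) K e-inverse v v≉0 trv≈0
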